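{- Every odd sun is not $S$-perfect.
   Context: A star is a tree with one vertex adjacent to all others ($K_1,K_2$ included). $\theta_S(G)$ is the minimum number of star subgraphs of $G$ covering $V(G)$; $T\subseteq V(G)$ is $S$-independent if no two of its vertices lie in a common star subgraph (pairwise distance at least $3$), and $\alpha_S(G)$ is the maximum size of such a set. $G$ is $S$-perfect if $\alpha_S(H)=\theta_S(H)$ for every induced subgraph $H$. $k$-sun: let $H$ be a graph with a Hamiltonian cycle $C=v_1v_2\dots v_kv_1$ ($k\ge3$); add new vertices $u_1,\dots,u_k$, with $u_i$ adjacent exactly to $v_i$ and $v_{i+1}$ (indices mod $k$). The result is a $k$-sun; it is an odd sun if $k$ is odd. -}

module Defs where

open import Data.Nat using (ℕ; zero; suc; _≤_; _+_; _*_)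
open import Data.Nat.DivMod using (_%_; m%n<n)

open import Data.Fin using (Fin; toℕ; fromℕ<)
open import Data.Fin.Subset using (Subset; _∈_; _⊆_; ∣_∣)
open import Data.List using (List; length)
open import Data.List.Relation.Unary.Any using (Any)
import Data.List.Membership.Propositional
open import Data.Product using (Σ; _×_; _,_; ∃-syntax)
open import Data.Sum using (_⊎_)
open import Relation.Binary.PropositionalEquality using (_≡_; _≢_)
open import Relation.Nullary using (¬_)
open import Function.Bundles using (_⇔_)
open import Function.Definitions using (Bijective)

record Graph (n : ℕ) : Set₁ where
  field
    Adj     : Fin n → Fin n → Set
    sym     : ∀ {x y} → Adj x y → Adj y x
    irrefl  : ∀ {x} → ¬ Adj x x
open Graph public

module _ {n : ℕ} (G : Graph n) where

  -- A star subgraph is given by its centre c and its set of leaves L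
  -- (all leaves adjacent to c; L = ∅ gives K₁, |L| = 1 gives K₂).
  -- Everything below is relative to the induced subgraph G[U], U ⊆ V(G).
  Star : Set
  Star = Fin n × Subset n

  IsStarOf : Subset n → Star → Set
  IsStarOf U (c , L) = c ∈ U × (∀ {x} → x ∈ L → x ∈ U × Adj G c x)

  InStar : Fin n → Star → Set
  InStar x (c , L) = x ≡ c ⊎ x ∈ L

  IsStarCover : Subset n → List Star → Set
  IsStarCover U ss =
    (∀ {s} → Data.List.Membership.Propositional._∈_ s ss → IsStarOf U s)
    × (∀ {x} → x ∈ U → Any (InStar x) ss)

  IsSIndep : Subset n → Subset n → Set
  IsSIndep U T =
    T ⊆ U ×
    (∀ {x y} → x ∈ T → y ∈ T → x ≢ y →
       ¬ (Σ Star λ s → IsStarOf U s × InStar x s × InStar y s))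

  IsAlphaS : Subset n → ℕ → Set
  IsAlphaS U a =
    (∃[ T ] (IsSIndep U T × ∣ T ∣ ≡ a)) ×
    (∀ T → IsSIndep U T → ∣ T ∣ ≤ a)

  IsThetaS : Subset n → ℕ → Set
  IsThetaS U t =
    (∃[ ss ] (IsStarCover U ss × length ss ≡ t)) ×
    (∀ ss → IsStarCover U ss → t ≤ length ss)

  SPerfect : Set
  SPerfect = ∀ (U : Subset n) (a t : ℕ) → IsAlphaS U a → IsThetaS U t → a ≡ t

next : ∀ {k} → Fin k → Fin k
next {suc k} i = fromℕ< (m%n<n (suc (toℕ i)) (suc k))

-- G is a k-sun: V(G) is the disjoint union of v₁..v_k and u₁..u_k
-- (f (inj₁ i) = v_i, f (inj₂ i) = u_i), v₁ v₂ … v_k v₁ is a (Hamiltonian)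
-- cycle of G[{v_i}] (other edges among the v_i arbitrary), u_i is adjacent
-- exactly to v_i and v_{i+1}, and the u_i are pairwise non-adjacent.
IsSun : ∀ {n} → Graph n → ℕ → Set
IsSun {n} G k =
  3 ≤ k ×
  Σ (Fin k ⊎ Fin k → Fin n) λ f →
    Bijective _≡_ _≡_ f ×
    (∀ i → Adj G (f (inj₁ i)) (f (inj₁ (next i)))) ×
    (∀ i j → Adj G (f (inj₂ i)) (f (inj₁ j)) ⇔ (j ≡ i ⊎ j ≡ next i)) ×
    (∀ i j → ¬ Adj G (f (inj₂ i)) (f (inj₂ j)))
  where open Data.Sum using (inj₁; inj₂)

IsOddSun : ∀ {n} → Graph n → Set
IsOddSun G = Σ ℕ λ k → (∃[ m ] k ≡ suc (2 * m)) × IsSun G k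

{-# OPTIONS --safe #-}
module Submission where

-- Work in the whole sun, k = 2m + 1. Give v_i and u_i the index i ∈ ℤ/k; the star
-- centred at v_{i+1} contains every vertex of index i or i + 1. So in an
-- S-independent set T the indices of the vertices and their successors are 2|T|
-- distinct elements of ℤ/k, whence α_S ≤ m, attained by u_0, u_2, …, u_{2m-2}.
-- Dually, a star centred at v_q contains only u_{q-1} and u_q among the u_i, and one
-- centred at u_p only u_p, so covering the k vertices u_i takes at least m + 1 stars;
-- the stars at v_1, v_3, …, v_{2m-1}, v_0 suffice. Hence α_S = m < m + 1 = θ_S.

open import Defs hiding (sym)
open import Data.Bool using (true; T)
open import Data.Empty using (⊥; ⊥-elim)
open import Data.Fin as Fin using (Fin; zero; suc; toℕ; splitAt; join)
open import Data.Fin.Properties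
  using (injective⇒≤; join-splitAt; splitAt-join; any?; _≟_; _<?_; <-cmp;
         toℕ-fromℕ<; toℕ-injective; toℕ<n)
  renaming (<-trans to <-transᶠ; <⇒≢ to <⇒≢ᶠ; suc-injective to suc-injectiveᶠ)
open import Data.Fin.Subset using (Subset; inside; outside; _∈_; ∣_∣; ⊤; ⁅_⁆; ⋃)
open import Data.Fin.Subset.Properties using (∈⊤; ∉⊥; x∈⁅x⁆; x∈⁅y⁆⇒x≡y; x∈p∪q⁻; x∈p∪q⁺)
open import Data.List as List using (List; []; _∷_; length)
open import Data.List.Membership.Propositional renaming (_∈_ to _∈ₗ_)
open import Data.List.Relation.Unary.All using (All; []; _∷_)
import Data.List.Relation.Unary.All as All
open import Data.List.Relation.Unary.Any as Any using (Any; here; there)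
open import Data.List.Relation.Unary.Any.Properties using (lookup-index; tabulate⁺)
open import Data.List.Membership.Propositional.Properties using (∈-lookup; ∈-tabulate⁻)
open import Data.List.Properties using (length-tabulate)
open import Data.Nat using (ℕ; zero; suc; _+_; _≤_; _<_; s≤s; z≤n; ⌊_/2⌋)
open import Data.Nat.DivMod using (_%_; _mod_; m<n⇒m%n≡m; m%n%n≡m%n; %-distribˡ-+; [m+n]%n≡m%n; n%n≡0)
open import Data.Nat.Properties
  using (⌊n/2⌋-mono; ⌈n/2⌉-mono; n≡⌊n+n/2⌋; n≡⌈n+n/2⌉; +-suc; +-comm; +-identityʳ;
         ≤-pred; ≤-trans; ≤-antisym; <⇒≤; +-mono-≤; +-mono-<; m≤n⇒m<n∨m≡n; n≤1+n; 1+n≢n; <⇒≢)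
open import Data.Product using (Σ; ∃; _×_; _,_; proj₁; proj₂)
open import Data.Sum using (_⊎_; inj₁; inj₂; [_,_])
open import Data.Sum.Properties using (inj₁-injective; inj₂-injective)
open import Data.Unit using (tt)
open import Data.Vec using (_∷_; here; there; tabulate)
open import Data.Vec.Properties using (lookup∘tabulate; []=⇒lookup; lookup⇒[]=)
open import Function using (_∘_)
open import Function.Bundles using (_⇔_; Equivalence)
open import Function.Definitions using (Injective; Bijective)
open import Relation.Binary using (tri<; tri≈; tri>)
open import Relation.Binary.PropositionalEquality hiding ([_])
open import Relation.Nullary using (¬_; Dec; yes; no; does)
open import Relation.Nullary.Decidable using (_×-dec_; dec-true; toWitness; isYes≗does)

private variable
  a b l m n K : ℕ

⌊n+n/2⌋≡n : ∀ n → ⌊ n + n /2⌋ ≡ n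
⌊n+n/2⌋≡n n = sym (n≡⌊n+n/2⌋ n)

⌊1+n+n/2⌋≡n : ∀ n → ⌊ suc (n + n) /2⌋ ≡ n
⌊1+n+n/2⌋≡n n = sym (n≡⌈n+n/2⌉ n)

n+n≤1+m+m⇒n≤m : ∀ {m n} → n + n ≤ suc (m + m) → n ≤ m
n+n≤1+m+m⇒n≤m {m} {n} le =
  subst₂ _≤_ (⌊n+n/2⌋≡n n) (⌊1+n+n/2⌋≡n m) (⌊n/2⌋-mono le)

1+m+m≤n+n⇒m<n : ∀ {m n} → suc (m + m) ≤ n + n → m < n
1+m+m≤n+n⇒m<n {m} {n} le =
  subst₂ _≤_ (cong suc (⌊n+n/2⌋≡n m)) (⌊1+n+n/2⌋≡n n) (⌈n/2⌉-mono le)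

data Parity : ℕ → Set where
  even : ∀ j → Parity (j + j)
  odd  : ∀ j → Parity (suc (j + j))

parity : ∀ t → Parity t
parity zero = even 0
parity (suc t) with parity t
... | even j = odd j
... | odd j  = subst Parity (+-suc (suc j) j) (even (suc j))

injective⇒+≤ : {h : Fin a ⊎ Fin b → Fin l} → Injective _≡_ _≡_ h → a + b ≤ l
injective⇒+≤ {a} {b} {h = h} h-inj = injective⇒≤ {f = h ∘ splitAt a} (splitAt-injective ∘ h-inj)
  where
  splitAt-injective : ∀ {i j} → splitAt a i ≡ splitAt a j → i ≡ j
  splitAt-injective {i} {j} e = begin
    i                      ≡⟨ join-splitAt a b i ⟨
    join a b (splitAt a i) ≡⟨ cong (join a b) e ⟩
    join a b (splitAt a j) ≡⟨ join-splitAt a b j ⟩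
    j                      ∎
    where open ≡-Reasoning

injective⇒≤+ : {h : Fin l → Fin a ⊎ Fin b} → Injective _≡_ _≡_ h → l ≤ a + b
injective⇒≤+ {a = a} {b} {h} h-inj = injective⇒≤ {f = join a b ∘ h} (h-inj ∘ join-injective)
  where
  join-injective : ∀ {x y} → join a b x ≡ join a b y → x ≡ y
  join-injective {x} {y} e = begin
    x                      ≡⟨ splitAt-join a b x ⟨
    splitAt a (join a b x) ≡⟨ cong (splitAt a) e ⟩
    splitAt a (join a b y) ≡⟨ splitAt-join a b y ⟩
    y                      ∎
    where open ≡-Reasoning

AtMostTwoToOne : (Fin l → Fin n) → Set
AtMostTwoToOne g = ∀ {x y z} → x ≢ y → y ≢ z → x ≢ z → g x ≡ g y → g y ≡ g z → ⊥

-- A point goes to the second copy of Fin n iff an earlier point shares its fibre.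
atMostTwoToOne⇒≤+ : (g : Fin l → Fin n) → AtMostTwoToOne g → l ≤ n + n
atMostTwoToOne⇒≤+ g twoToOne = injective⇒≤+ {h = λ i → tag i (hasEarlier? i)} λ {i} {j} → tag-injective i j _ _
  where
  HasEarlier : Fin _ → Set
  HasEarlier i = ∃ λ j → j Fin.< i × g j ≡ g i

  hasEarlier? : ∀ i → Dec (HasEarlier i)
  hasEarlier? i = any? λ j → (j <? i) ×-dec (g j ≟ g i)

  tag : ∀ i → Dec (HasEarlier i) → Fin _ ⊎ Fin _
  tag i (no _)  = inj₁ (g i)
  tag i (yes _) = inj₂ (g i)

  tag-injective : ∀ i j di dj → tag i di ≡ tag j dj → i ≡ j
  tag-injective i j (no ¬ei) (no ¬ej) e with inj₁-injective e | <-cmp i j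
  ... | gi≡gj | tri< i<j _ _ = ⊥-elim (¬ej (i , i<j , gi≡gj))
  ... | _     | tri≈ _ i≡j _ = i≡j
  ... | gi≡gj | tri> _ _ j<i = ⊥-elim (¬ei (j , j<i , sym gi≡gj))
  tag-injective i j (yes (i′ , i′<i , gi′≡gi)) (yes (j′ , j′<j , gj′≡gj)) e with inj₂-injective e | <-cmp i j
  ... | gi≡gj | tri< i<j _ _ =
    ⊥-elim (twoToOne (<⇒≢ᶠ i′<i) (<⇒≢ᶠ i<j) (<⇒≢ᶠ (<-transᶠ i′<i i<j)) gi′≡gi gi≡gj)
  ... | _     | tri≈ _ i≡j _ = i≡j
  ... | gi≡gj | tri> _ _ j<i =
    ⊥-elim (twoToOne (<⇒≢ᶠ j′<j) (<⇒≢ᶠ j<i) (<⇒≢ᶠ (<-transᶠ j′<j j<i)) gj′≡gj (sym gi≡gj))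

enum : (p : Subset n) → Fin ∣ p ∣ → Fin n
enum (inside  ∷ p) zero    = zero
enum (inside  ∷ p) (suc r) = suc (enum p r)
enum (outside ∷ p) r       = suc (enum p r)

enum-∈ : (p : Subset n) (r : Fin ∣ p ∣) → enum p r ∈ p
enum-∈ (inside  ∷ p) zero    = here
enum-∈ (inside  ∷ p) (suc r) = there (enum-∈ p r)
enum-∈ (outside ∷ p) r       = there (enum-∈ p r)

enum-injective : (p : Subset n) → Injective _≡_ _≡_ (enum p)
enum-injective (inside  ∷ p) {zero}  {zero}  _ = refl
enum-injective (inside  ∷ p) {suc r} {suc s} e = cong suc (enum-injective p (suc-injectiveᶠ e))
enum-injective (outside ∷ p)                 e = enum-injective p (suc-injectiveᶠ e)

rank : (p : Subset n) {x : Fin n} → x ∈ p → Fin ∣ p ∣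
rank (inside  ∷ p) here        = zero
rank (inside  ∷ p) (there x∈p) = suc (rank p x∈p)
rank (outside ∷ p) (there x∈p) = rank p x∈p

enum-rank : (p : Subset n) {x : Fin n} (x∈p : x ∈ p) → enum p (rank p x∈p) ≡ x
enum-rank (inside  ∷ p) here        = refl
enum-rank (inside  ∷ p) (there x∈p) = cong suc (enum-rank p x∈p)
enum-rank (outside ∷ p) (there x∈p) = cong suc (enum-rank p x∈p)

injective⇒≤∣p∣ : (p : Subset n) {h : Fin m → Fin n} →
                 Injective _≡_ _≡_ h → (∀ i → h i ∈ p) → m ≤ ∣ p ∣
injective⇒≤∣p∣ p {h} h-inj h∈p = injective⇒≤ {f = λ i → rank p (h∈p i)} λ {i} {j} e →
  h-inj (trans (sym (enum-rank p (h∈p i))) (trans (cong (enum p) e) (enum-rank p (h∈p j))))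

InjectiveOn : Subset n → (Fin n → Fin l) → Set
InjectiveOn p g = ∀ {x y} → x ∈ p → y ∈ p → g x ≡ g y → x ≡ y

injectiveOn-disjoint⇒∣p∣+∣p∣≤ : (p : Subset n) (g₁ g₂ : Fin n → Fin l) →
  InjectiveOn p g₁ → InjectiveOn p g₂ → (∀ {x y} → x ∈ p → y ∈ p → g₁ x ≢ g₂ y) →
  ∣ p ∣ + ∣ p ∣ ≤ l
injectiveOn-disjoint⇒∣p∣+∣p∣≤ p g₁ g₂ g₁-inj g₂-inj disjoint = injective⇒+≤ {h = h} λ {r} {s} → h-injective r s
  where
  h : Fin ∣ p ∣ ⊎ Fin ∣ p ∣ → Fin _
  h = [ g₁ ∘ enum p , g₂ ∘ enum p ]

  h-injective : ∀ r s → h r ≡ h s → r ≡ s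
  h-injective (inj₁ r) (inj₁ s) e = cong inj₁ (enum-injective p (g₁-inj (enum-∈ p r) (enum-∈ p s) e))
  h-injective (inj₁ r) (inj₂ s) e = ⊥-elim (disjoint (enum-∈ p r) (enum-∈ p s) e)
  h-injective (inj₂ r) (inj₁ s) e = ⊥-elim (disjoint (enum-∈ p s) (enum-∈ p r) (sym e))
  h-injective (inj₂ r) (inj₂ s) e = cong inj₂ (enum-injective p (g₂-inj (enum-∈ p r) (enum-∈ p s) e))

image : (Fin m → Fin n) → Subset n
image h = tabulate λ x → does (any? λ i → h i ≟ x)

∈-image⁺ : (h : Fin m → Fin n) (i : Fin m) → h i ∈ image h
∈-image⁺ h i = lookup⇒[]= (h i) (image h)
  (trans (lookup∘tabulate _ (h i)) (dec-true (any? λ j → h j ≟ h i) (i , refl)))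

∈-image⁻ : (h : Fin m → Fin n) {x : Fin n} → x ∈ image h → ∃ λ i → h i ≡ x
∈-image⁻ h {x} x∈ = toWitness {a? = x?} (subst T (sym (trans (isYes≗does x?) x∈image)) tt)
  where
  x? : Dec (∃ λ i → h i ≡ x)
  x? = any? λ i → h i ≟ x
  x∈image : does x? ≡ true
  x∈image = trans (sym (lookup∘tabulate _ x)) ([]=⇒lookup x∈)

toℕ-mod : ∀ t → toℕ (t mod suc K) ≡ t % suc K
toℕ-mod {K} t = toℕ-fromℕ< _

toℕ-mod-< : ∀ {t} → t < suc K → toℕ (t mod suc K) ≡ t
toℕ-mod-< {K} {t} lt = trans (toℕ-mod t) (m<n⇒m%n≡m lt)

toℕ-mod-self : (i : Fin (suc K)) → toℕ i mod suc K ≡ i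
toℕ-mod-self i = toℕ-injective (toℕ-mod-< (toℕ<n i))

[m%n+o]%n≡[m+o]%n : ∀ m o n → (m % suc n + o) % suc n ≡ (m + o) % suc n
[m%n+o]%n≡[m+o]%n m o n = begin
  (m % suc n + o) % suc n                  ≡⟨ %-distribˡ-+ (m % suc n) o (suc n) ⟩
  (m % suc n % suc n + o % suc n) % suc n  ≡⟨ cong (λ z → (z + o % suc n) % suc n) (m%n%n≡m%n m (suc n)) ⟩
  (m % suc n + o % suc n) % suc n          ≡⟨ %-distribˡ-+ m o (suc n) ⟨
  (m + o) % suc n                          ∎
  where open ≡-Reasoning

next-mod : ∀ t → next (t mod suc K) ≡ suc t mod suc K
next-mod {K} t = toℕ-injective (begin
  toℕ (next (t mod suc K))   ≡⟨ toℕ-mod (suc (toℕ (t mod suc K))) ⟩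
  suc (toℕ (t mod suc K)) % suc K ≡⟨ cong (λ z → suc z % suc K) (toℕ-mod t) ⟩
  suc (t % suc K) % suc K    ≡⟨ cong (_% suc K) (+-comm 1 (t % suc K)) ⟩
  (t % suc K + 1) % suc K    ≡⟨ [m%n+o]%n≡[m+o]%n t 1 K ⟩
  (t + 1) % suc K            ≡⟨ cong (_% suc K) (+-comm t 1) ⟩
  suc t % suc K              ≡⟨ toℕ-mod (suc t) ⟨
  toℕ (suc t mod suc K)      ∎)
  where open ≡-Reasoning

prev : Fin (suc K) → Fin (suc K)
prev {K} i = (toℕ i + K) mod suc K

prev-next : (i : Fin (suc K)) → prev (next i) ≡ i
prev-next {K} i = toℕ-injective (begin
  toℕ (prev (next i))                  ≡⟨ toℕ-mod {K} (toℕ (next i) + K) ⟩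
  (toℕ (next i) + K) % suc K           ≡⟨ cong (λ z → (z + K) % suc K) (toℕ-mod {K} (suc (toℕ i))) ⟩
  (suc (toℕ i) % suc K + K) % suc K    ≡⟨ [m%n+o]%n≡[m+o]%n (suc (toℕ i)) K K ⟩
  (suc (toℕ i) + K) % suc K            ≡⟨ cong (_% suc K) (sym (+-suc (toℕ i) K)) ⟩
  (toℕ i + suc K) % suc K              ≡⟨ [m+n]%n≡m%n (toℕ i) (suc K) ⟩
  toℕ i % suc K                        ≡⟨ m<n⇒m%n≡m (toℕ<n i) ⟩
  toℕ i                                ∎)
  where open ≡-Reasoning

next-injective : {i j : Fin (suc K)} → next i ≡ next j → i ≡ j
next-injective {i = i} {j} e = trans (sym (prev-next i)) (trans (cong prev e) (prev-next j))

next-≢ : 1 ≤ K → (i : Fin (suc K)) → next i ≢ i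
next-≢ {K} 1≤K i e with m≤n⇒m<n∨m≡n (≤-pred (toℕ<n i))
... | inj₁ i<K = 1+n≢n (trans (sym (toℕ-mod-< (s≤s i<K))) (cong toℕ e))
... | inj₂ i≡K = <⇒≢ 1≤K (begin
  0                  ≡⟨ n%n≡0 (suc K) ⟨
  suc K % suc K      ≡⟨ cong (λ z → suc z % suc K) i≡K ⟨
  suc (toℕ i) % suc K ≡⟨ toℕ-mod {K} (suc (toℕ i)) ⟨
  toℕ (next i)       ≡⟨ cong toℕ e ⟩
  toℕ i              ≡⟨ i≡K ⟩
  K                  ∎)
  where open ≡-Reasoning

fromList : List (Fin n) → Subset n
fromList xs = ⋃ (List.map ⁅_⁆ xs)

∈-fromList⁺ : {x : Fin n} (xs : List (Fin n)) → x ∈ₗ xs → x ∈ fromList xs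
∈-fromList⁺ (x ∷ _)  (here refl)  = x∈p∪q⁺ (inj₁ (x∈⁅x⁆ x))
∈-fromList⁺ (_ ∷ ys) (there x∈ys) = x∈p∪q⁺ (inj₂ (∈-fromList⁺ ys x∈ys))

∈-fromList⁻ : {x : Fin n} (xs : List (Fin n)) → x ∈ fromList xs → x ∈ₗ xs
∈-fromList⁻ []       x∈ = ⊥-elim (∉⊥ x∈)
∈-fromList⁻ (y ∷ ys) x∈ with x∈p∪q⁻ ⁅ y ⁆ (fromList ys) x∈
... | inj₁ x∈⁅y⁆ = here (x∈⁅y⁆⇒x≡y y x∈⁅y⁆)
... | inj₂ x∈ys  = there (∈-fromList⁻ ys x∈ys)

module _ (G : Graph n) where

  SameStar : Fin n → Fin n → Set
  SameStar x y = Σ (Star G) λ s → IsStarOf G ⊤ s × InStar G x s × InStar G y s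

  fromList-isStar : {c : Fin n} (xs : List (Fin n)) → All (Adj G c) xs → IsStarOf G ⊤ (c , fromList xs)
  fromList-isStar xs adj = ∈⊤ , λ x∈ → ∈⊤ , All.lookup adj (∈-fromList⁻ xs x∈)

module Sun {n} (G : Graph n) {K : ℕ} (3≤k : 3 ≤ suc K)
  (f : Fin (suc K) ⊎ Fin (suc K) → Fin n) (f-bijective : Bijective _≡_ _≡_ f)
  (cycle : ∀ i → Adj G (f (inj₁ i)) (f (inj₁ (next i))))
  (u-adj-v : ∀ i j → Adj G (f (inj₂ i)) (f (inj₁ j)) ⇔ (j ≡ i ⊎ j ≡ next i))
  (u-nonadj : ∀ i j → ¬ Adj G (f (inj₂ i)) (f (inj₂ j))) where

  v u : Fin (suc K) → Fin n
  v i = f (inj₁ i)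
  u i = f (inj₂ i)

  f-injective : Injective _≡_ _≡_ f
  f-injective = proj₁ f-bijective

  v-injective : {i j : Fin (suc K)} → v i ≡ v j → i ≡ j
  v-injective = inj₁-injective ∘ f-injective

  u-injective : {i j : Fin (suc K)} → u i ≡ u j → i ≡ j
  u-injective = inj₂-injective ∘ f-injective

  u≢v : {i j : Fin (suc K)} → u i ≢ v j
  u≢v e with f-injective e
  ... | ()

  data Vertex : Fin n → Set where
    vertex-v : ∀ i → Vertex (v i)
    vertex-u : ∀ i → Vertex (u i)

  vertex : ∀ x → Vertex x
  vertex x = subst Vertex (proj₂ (proj₂ f-bijective x) refl) (side (proj₁ (proj₂ f-bijective x)))
    where
    side : ∀ w → Vertex (f w)
    side (inj₁ i) = vertex-v i
    side (inj₂ i) = vertex-u i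

  vertex-index : {x : Fin n} → Vertex x → Fin (suc K)
  vertex-index (vertex-v i) = i
  vertex-index (vertex-u i) = i

  index : Fin n → Fin (suc K)
  index x = vertex-index (vertex x)

  pairLeaves : Fin (suc K) → List (Fin n)
  pairLeaves i = v i ∷ u i ∷ u (next i) ∷ []

  pairStar : Fin (suc K) → Star G
  pairStar i = v (next i) , fromList (pairLeaves i)

  pairStar-isStar : ∀ i → IsStarOf G ⊤ (pairStar i)
  pairStar-isStar i = fromList-isStar G (pairLeaves i)
    (Graph.sym G (cycle i) ∷
     Graph.sym G (Equivalence.from (u-adj-v i (next i)) (inj₂ refl)) ∷
     Graph.sym G (Equivalence.from (u-adj-v (next i) (next i)) (inj₁ refl)) ∷ [])

  ∈-pairStar : ∀ {i} x → index x ≡ i ⊎ index x ≡ next i → InStar G x (pairStar i)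
  ∈-pairStar x = ∈-pairStar′ (vertex x)
    where
    ∈-pairStar′ : ∀ {i x} (w : Vertex x) → vertex-index w ≡ i ⊎ vertex-index w ≡ next i →
                  InStar G x (pairStar i)
    ∈-pairStar′ (vertex-v i) (inj₁ refl) = inj₂ (∈-fromList⁺ (pairLeaves i) (here refl))
    ∈-pairStar′ (vertex-v _) (inj₂ refl) = inj₁ refl
    ∈-pairStar′ (vertex-u i) (inj₁ refl) = inj₂ (∈-fromList⁺ (pairLeaves i) (there (here refl)))
    ∈-pairStar′ {i} (vertex-u _) (inj₂ refl) =
      inj₂ (∈-fromList⁺ (pairLeaves i) (there (there (here refl))))

  sIndep⇒∣T∣+∣T∣≤k : {T : Subset n} → IsSIndep G ⊤ T → ∣ T ∣ + ∣ T ∣ ≤ suc K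
  sIndep⇒∣T∣+∣T∣≤k {T} (_ , indep) =
    injectiveOn-disjoint⇒∣p∣+∣p∣≤ T index (next ∘ index)
      index-injective (λ x∈ y∈ → index-injective x∈ y∈ ∘ next-injective) disjoint
    where
    pairStar-separates : ∀ {x y} → x ∈ T → y ∈ T → index x ≡ index y ⊎ index x ≡ next (index y) → x ≡ y
    pairStar-separates {x} {y} x∈ y∈ near with x ≟ y
    ... | yes x≡y = x≡y
    ... | no x≢y  = ⊥-elim (indep x∈ y∈ x≢y
      (pairStar (index y) , pairStar-isStar (index y) , ∈-pairStar x near , ∈-pairStar y (inj₁ refl)))

    index-injective : InjectiveOn T index
    index-injective x∈ y∈ e = pairStar-separates x∈ y∈ (inj₁ e)

    disjoint : ∀ {x y} → x ∈ T → y ∈ T → index x ≢ next (index y)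
    disjoint {x} x∈ y∈ e with pairStar-separates x∈ y∈ (inj₂ e)
    ... | refl = next-≢ (≤-trans (s≤s z≤n) (≤-pred 3≤k)) (index x) (sym e)

  Flanks : Fin (suc K) → Fin (suc K) → Set
  Flanks q a = q ≡ a ⊎ q ≡ next a

  u∈star : ∀ {c L a} → IsStarOf G ⊤ (c , L) → InStar G (u a) (c , L) →
           c ≡ u a ⊎ ∃ λ q → c ≡ v q × Flanks q a
  u∈star {c} = u∈star′ (vertex c)
    where
    u∈star′ : ∀ {c L a} → Vertex c → IsStarOf G ⊤ (c , L) → InStar G (u a) (c , L) →
              c ≡ u a ⊎ ∃ λ q → c ≡ v q × Flanks q a
    u∈star′ (vertex-v q) _ (inj₁ ua≡vq) = ⊥-elim (u≢v ua≡vq)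
    u∈star′ {a = a} (vertex-v q) (_ , leaf) (inj₂ ua∈L) =
      inj₂ (q , refl , Equivalence.to (u-adj-v a q) (Graph.sym G (proj₂ (leaf ua∈L))))
    u∈star′ (vertex-u p) _ (inj₁ ua≡up) = inj₁ (sym ua≡up)
    u∈star′ {a = a} (vertex-u p) (_ , leaf) (inj₂ ua∈L) = ⊥-elim (u-nonadj p a (proj₂ (leaf ua∈L)))

  distinct-u∈star⇒flanks : ∀ {c L a b} → a ≢ b → IsStarOf G ⊤ (c , L) →
    InStar G (u a) (c , L) → InStar G (u b) (c , L) → ∃ λ q → c ≡ v q × Flanks q a × Flanks q b
  distinct-u∈star⇒flanks a≢b isStar ua∈ ub∈ with u∈star isStar ua∈ | u∈star isStar ub∈
  ... | inj₁ c≡ua | inj₁ c≡ub = ⊥-elim (a≢b (u-injective (trans (sym c≡ua) c≡ub)))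
  ... | inj₁ c≡ua | inj₂ (_ , c≡vq , _) = ⊥-elim (u≢v (trans (sym c≡ua) c≡vq))
  ... | inj₂ (_ , c≡vq , _) | inj₁ c≡ub = ⊥-elim (u≢v (trans (sym c≡ub) c≡vq))
  ... | inj₂ (q , c≡vq , qa) | inj₂ (q′ , c≡vq′ , q′b) with v-injective (trans (sym c≡vq) c≡vq′)
  ... | refl = q , c≡vq , qa , q′b

  flanks-at-most-two : ∀ {q a b c} → a ≢ b → b ≢ c → a ≢ c → Flanks q a → Flanks q b → Flanks q c → ⊥
  flanks-at-most-two a≢b _ _ (inj₁ refl) (inj₁ refl) _ = a≢b refl
  flanks-at-most-two a≢b _ _ (inj₂ qa) (inj₂ qb) _ = a≢b (next-injective (trans (sym qa) qb))
  flanks-at-most-two _ _ a≢c (inj₁ refl) (inj₂ _) (inj₁ refl) = a≢c refl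
  flanks-at-most-two _ b≢c _ (inj₁ refl) (inj₂ qb) (inj₂ qc) = b≢c (next-injective (trans (sym qb) qc))
  flanks-at-most-two _ b≢c _ (inj₂ _) (inj₁ refl) (inj₁ refl) = b≢c refl
  flanks-at-most-two _ _ a≢c (inj₂ qa) (inj₁ refl) (inj₂ qc) = a≢c (next-injective (trans (sym qa) qc))

  u∈star-at-most-two : ∀ {s a b c} → IsStarOf G ⊤ s → a ≢ b → b ≢ c → a ≢ c →
    InStar G (u a) s → InStar G (u b) s → InStar G (u c) s → ⊥
  u∈star-at-most-two isStar a≢b b≢c a≢c ua∈ ub∈ uc∈
    with distinct-u∈star⇒flanks a≢b isStar ua∈ ub∈ | distinct-u∈star⇒flanks b≢c isStar ub∈ uc∈
  ... | q , c≡vq , qa , qb | q′ , c≡vq′ , _ , q′c with v-injective (trans (sym c≡vq) c≡vq′)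
  ... | refl = flanks-at-most-two a≢b b≢c a≢c qa qb q′c

  starCover⇒k≤ : {ss : List (Star G)} → IsStarCover G ⊤ ss → suc K ≤ length ss + length ss
  starCover⇒k≤ {ss} (isStar , covers) = atMostTwoToOne⇒≤+ coveringStar λ a≢b b≢c a≢c ga≡gb gb≡gc →
    u∈star-at-most-two (isStar (∈-lookup _)) a≢b b≢c a≢c
      (∈-coveringStar _) (subst (InStar G _ ∘ List.lookup ss) (sym ga≡gb) (∈-coveringStar _))
      (subst (InStar G _ ∘ List.lookup ss) (sym (trans ga≡gb gb≡gc)) (∈-coveringStar _))
    where
    coveringStar : Fin (suc K) → Fin (length ss)
    coveringStar a = Any.index (covers (∈⊤ {x = u a}))

    ∈-coveringStar : ∀ a → InStar G (u a) (List.lookup ss (coveringStar a))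
    ∈-coveringStar a = lookup-index (covers ∈⊤)

module OddSun {n} (G : Graph n) (m : ℕ) (3≤k : 3 ≤ suc (m + m))
  (f : Fin (suc (m + m)) ⊎ Fin (suc (m + m)) → Fin n) (f-bijective : Bijective _≡_ _≡_ f)
  (cycle : ∀ i → Adj G (f (inj₁ i)) (f (inj₁ (next i))))
  (u-adj-v : ∀ i j → Adj G (f (inj₂ i)) (f (inj₁ j)) ⇔ (j ≡ i ⊎ j ≡ next i))
  (u-nonadj : ∀ i j → ¬ Adj G (f (inj₂ i)) (f (inj₂ j))) where

  open Sun G 3≤k f f-bijective cycle u-adj-v u-nonadj

  k : ℕ
  k = suc (m + m)

  double : ℕ → Fin k
  double j = (j + j) mod k

  toℕ-double : ∀ {j} → j ≤ m → toℕ (double j) ≡ j + j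
  toℕ-double j≤m = toℕ-mod-< (s≤s (+-mono-≤ j≤m j≤m))

  toℕ-next-double : ∀ {j} → j < m → toℕ (next (double j)) ≡ suc (j + j)
  toℕ-next-double {j} j<m = trans (cong toℕ (next-mod (j + j))) (toℕ-mod-< (s≤s (+-mono-< j<m j<m)))

  flanks-double⇒half : ∀ {j q} → j < m → Flanks q (double j) → ⌊ toℕ q /2⌋ ≡ j
  flanks-double⇒half {j} j<m (inj₁ refl) = trans (cong ⌊_/2⌋ (toℕ-double (<⇒≤ j<m))) (⌊n+n/2⌋≡n j)
  flanks-double⇒half {j} j<m (inj₂ refl) = trans (cong ⌊_/2⌋ (toℕ-next-double j<m)) (⌊1+n+n/2⌋≡n j)

  uEven : Fin m → Fin n
  uEven j = u (double (toℕ j))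

  uEven-injective : Injective _≡_ _≡_ uEven
  uEven-injective {a} {b} e = toℕ-injective (begin
    toℕ a                      ≡⟨ ⌊n+n/2⌋≡n (toℕ a) ⟨
    ⌊ toℕ a + toℕ a /2⌋        ≡⟨ cong ⌊_/2⌋ (toℕ-double (<⇒≤ (toℕ<n a))) ⟨
    ⌊ toℕ (double (toℕ a)) /2⌋ ≡⟨ cong (λ i → ⌊ toℕ i /2⌋) (u-injective e) ⟩
    ⌊ toℕ (double (toℕ b)) /2⌋ ≡⟨ cong ⌊_/2⌋ (toℕ-double (<⇒≤ (toℕ<n b))) ⟩
    ⌊ toℕ b + toℕ b /2⌋        ≡⟨ ⌊n+n/2⌋≡n (toℕ b) ⟩
    toℕ b                      ∎)
    where open ≡-Reasoning

  T₀ : Subset n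
  T₀ = image uEven

  T₀-sIndep : IsSIndep G ⊤ T₀
  T₀-sIndep = (λ _ → ∈⊤) , separated
    where
    separated : ∀ {x y} → x ∈ T₀ → y ∈ T₀ → x ≢ y → ¬ SameStar G x y
    separated x∈ y∈ x≢y ((c , L) , isStar , x∈s , y∈s) with ∈-image⁻ uEven x∈ | ∈-image⁻ uEven y∈
    ... | a , refl | b , refl
      with distinct-u∈star⇒flanks (x≢y ∘ cong u) isStar x∈s y∈s
    ... | _ , _ , qa , qb = x≢y (cong uEven (toℕ-injective
      (trans (sym (flanks-double⇒half (toℕ<n a) qa)) (flanks-double⇒half (toℕ<n b) qb))))

  sIndep⇒∣T∣≤m : ∀ {T} → IsSIndep G ⊤ T → ∣ T ∣ ≤ m
  sIndep⇒∣T∣≤m = n+n≤1+m+m⇒n≤m ∘ sIndep⇒∣T∣+∣T∣≤k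

  αS≡m : IsAlphaS G ⊤ m
  αS≡m = (T₀ , T₀-sIndep , ∣T₀∣≡m) , λ _ → sIndep⇒∣T∣≤m
    where
    ∣T₀∣≡m : ∣ T₀ ∣ ≡ m
    ∣T₀∣≡m = ≤-antisym (sIndep⇒∣T∣≤m T₀-sIndep) (injective⇒≤∣p∣ T₀ uEven-injective (∈-image⁺ uEven))

  double-or-next-double : (i : Fin k) → ∃ λ j → j ≤ m × (i ≡ double j ⊎ i ≡ next (double j))
  double-or-next-double i = subst (λ i′ → ∃ λ j → j ≤ m × (i′ ≡ double j ⊎ i′ ≡ next (double j)))
    (toℕ-mod-self i) (at (toℕ<n i) (parity (toℕ i)))
    where
    at : ∀ {t} → t < k → Parity t → ∃ λ j → j ≤ m × (t mod k ≡ double j ⊎ t mod k ≡ next (double j))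
    at t<k (even j) = j , n+n≤1+m+m⇒n≤m (<⇒≤ t<k) , inj₁ refl
    at t<k (odd j)  = j , n+n≤1+m+m⇒n≤m (≤-trans (n≤1+n (j + j)) (<⇒≤ t<k)) , inj₂ (sym (next-mod (j + j)))

  coverStar : Fin (suc m) → Star G
  coverStar j = pairStar (double (toℕ j))

  cover : List (Star G)
  cover = List.tabulate coverStar

  cover-isStarCover : IsStarCover G ⊤ cover
  cover-isStarCover = isStar , covers
    where
    isStar : ∀ {s} → s ∈ₗ cover → IsStarOf G ⊤ s
    isStar s∈ with ∈-tabulate⁻ {f = coverStar} s∈
    ... | j , refl = pairStar-isStar (double (toℕ j))

    covers : ∀ {x} → x ∈ ⊤ → Any (InStar G x) cover
    covers {x} _ with double-or-next-double (index x)
    ... | j , j≤m , near = tabulate⁺ {f = coverStar} (Fin.fromℕ< (s≤s j≤m))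
      (subst (λ t → InStar G x (pairStar (double t))) (sym (toℕ-fromℕ< (s≤s j≤m))) (∈-pairStar x near))

  θS≡1+m : IsThetaS G ⊤ (suc m)
  θS≡1+m = (cover , cover-isStarCover , length-tabulate coverStar) ,
           λ ss isCover → 1+m+m≤n+n⇒m<n (starCover⇒k≤ {ss} isCover)

  ¬sPerfect : ¬ SPerfect G
  ¬sPerfect sPerfect = 1+n≢n (sym (sPerfect ⊤ m (suc m) αS≡m θS≡1+m))

lemma2p11 : ∀ (n : ℕ) (G : Graph n) → IsOddSun G → ¬ SPerfect G
lemma2p11 n G (_ , (m , refl) , sun) with subst (IsSun G) (cong (λ z → suc (m + z)) (+-identityʳ m)) sun
... | 3≤k , f , f-bijective , cycle , u-adj-v , u-nonadj =
  OddSun.¬sPerfect G m 3≤k f f-bijective cycle u-adj-v u-nonadj
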